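{- Let $n,m$ be positive integers and $(a,b)=(n,mn+1)$. Let $\pi\in\mathsf{NC}(n,mn+1)$ be an $m$-divisible noncrossing partition of $[mn]$ (every block has size divisible by $m$), and let $B$ be a block of $\pi$. Then $\mathrm{rank}^{\pi}_{n,mn+1}(B)=\frac{|B|}{m}$.
   Context: For coprime positive integers $a<b$: an $a,b$-Dyck path is a lattice path from $(0,0)$ to $(b,a)$ using unit north and east steps that stays weakly above the line $y=\frac{a}{b}x$. A valley of such a path $D$ is a lattice point of $D$ immediately preceded by an east step and immediately followed by a north step. From each valley $P$ fire the laser $\ell(P)$: the segment of slope $\frac ab$ from $P$ going northeast until it first meets $D$ again. Label the east endpoints of the first $b-1$ east steps of $D$ from left to right by $1,\dots,b-1$, each label regarded as sitting slightly below its lattice point. The set partition $\pi(D)$ of $[b-1]$ declares $i\sim j$ iff labels $i,j$ are not separated by any valley laser. $\mathsf{NC}(a,b)=\{\pi(D): D\text{ an }a,b\text{ -Dyck path}\}$. Rank: for a noncrossing partition $\pi$ of $[b-1]$, order its blocks by $B'\preceq B$ iff $[\min B',\max B']\subseteq[\min B,\max B]$; the integers $\mathrm{rank}^{\pi}_{a,b}(B)$ are the unique integers with $\sum_{B'\preceq B}\mathrm{rank}^{\pi}_{a,b}(B')=\lceil(\max B-\min B+1)\frac ab\rceil$ for all blocks $B$. -}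

module Defs where

open import Data.Nat using (ℕ; zero; suc; _+_; _*_; _∸_; _≤_; _<_; _/_; NonZero)
open import Data.Nat.Divisibility using (_∣_)
open import Data.Nat.Properties using (_≤?_; _<?_; _≟_)
open import Data.Bool using (Bool; true; false; _∧_; if_then_else_)
open import Data.List using (List; []; _∷_; length; filter; map; foldr)
open import Data.List.Membership.Propositional using (_∈_)
open import Data.Integer using (ℤ; +_)
import Data.Integer as ℤ
open import Data.Product using (_×_; _,_; Σ)
open import Relation.Nullary.Decidable using (⌊_⌋)
open import Relation.Binary.PropositionalEquality using (_≡_)

allB : {A : Set} → (A → Bool) → List A → Bool
allB p []      = true
allB p (x ∷ s) = p x ∧ allB p s

data Step : Set where
  N E : Step

#N #E : List Step → ℕ
#N []      = 0
#N (N ∷ s) = suc (#N s)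
#N (E ∷ s) = #N s
#E []      = 0
#E (N ∷ s) = #E s
#E (E ∷ s) = suc (#E s)

prefixes : List Step → List (List Step)
prefixes []      = [] ∷ []
prefixes (x ∷ s) = [] ∷ map (x ∷_) (prefixes s)

-- An a,b-Dyck path: a lattice path from (0,0) to (b,a) using N and E
-- unit steps that stays weakly above the line y = (a/b) x.  Since the
-- path consists of unit steps it suffices (and is equivalent) to ask
-- that every lattice point (x,y) visited satisfy b*y ≥ a*x.
record DyckPath (a b : ℕ) : Set where
  constructor mkDyck
  field
    steps   : List Step
    nEast   : #E steps ≡ b
    nNorth  : #N steps ≡ a
    above   : ∀ p → p ∈ prefixes steps → a * #E p ≤ b * #N p
open DyckPath public

valleysFrom : ℕ → ℕ → List Step → List (ℕ × ℕ)
valleysFrom x y []            = []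
valleysFrom x y (N ∷ s)       = valleysFrom x (suc y) s
valleysFrom x y (E ∷ [])      = []
valleysFrom x y (E ∷ N ∷ s)   = (suc x , y) ∷ valleysFrom (suc x) y (N ∷ s)
valleysFrom x y (E ∷ E ∷ s)   = valleysFrom (suc x) y (E ∷ s)

valleys : List Step → List (ℕ × ℕ)
valleys = valleysFrom 0 0

-- eastHeight s c : the height (y-coordinate) of the c-th east step of s
-- (c ≥ 1), i.e. the number of north steps preceding it.  Its east
-- endpoint is the lattice point (c , eastHeight s c).
eastHeight : List Step → ℕ → ℕ
eastHeight []      c             = 0
eastHeight (N ∷ s) c             = suc (eastHeight s c)
eastHeight (E ∷ s) zero          = 0
eastHeight (E ∷ s) (suc zero)    = 0
eastHeight (E ∷ s) (suc (suc c)) = eastHeight s (suc c)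

-- The laser ℓ(P) from a valley P = (x , y) is the segment of
-- slope a/b from P going northeast until it first meets the path again.
-- The laser passes through no lattice point other than P inside the
-- box (gcd(a,b) = 1), the path lies strictly above it at every integer
-- column c with x < c before the laser meets the path, and the laser
-- meets the path on (the interior of) the east step ending at the first
-- column c > x where the laser height y + (a/b)(c - x) exceeds the
-- height of that east step, i.e.  b*y + a*c > b*eastHeight c + a*x.
--
-- Hence the labels lying in the region cut off by ℓ(P) (between the
-- laser and the path) are exactly the labels i with x < i such that
-- every column c with x < c ≤ i has the path strictly above the laser:
--   b*y + a*c < b*eastHeight c + a*x.
-- (A label i sits slightly below the lattice point (i , eastHeight i);
-- the label x sits slightly below P itself, hence below ℓ(P).)

range : ℕ → ℕ → List ℕ
range lo zero    = []
range lo (suc k) = suc lo ∷ range (suc lo) k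

[1…_] : ℕ → List ℕ
[1… k ] = range 0 k

underLaser : (a b : ℕ) → List Step → ℕ × ℕ → ℕ → Bool
underLaser a b s (x , y) i =
  ⌊ x <? i ⌋ ∧
  allB (λ c → ⌊ b * y + a * c <? b * eastHeight s c + a * x ⌋) (range x (i ∸ x))

separates : (a b : ℕ) → List Step → ℕ × ℕ → ℕ → ℕ → Bool
separates a b s P i j with underLaser a b s P i | underLaser a b s P j
... | true  | true  = false
... | false | false = false
... | _     | _     = true

-- The set partition π(D) of [b-1], as its (decidable) "same block"
-- relation: i ∼ j iff no valley laser separates labels i and j.
sameBlock : (a b : ℕ) → DyckPath a b → ℕ → ℕ → Bool
sameBlock a b D i j =
  allB (λ P → if separates a b (steps D) P i j then false else true)
      (valleys (steps D))

blockOf : (a b : ℕ) → DyckPath a b → ℕ → List ℕ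
blockOf a b D i = filter (λ j → sameBlock a b D i j Data.Bool.≟ true) [1… b ∸ 1 ]

minL maxL : List ℕ → ℕ
minL []      = 0
minL (x ∷ []) = x
minL (x ∷ y ∷ s) = Data.Nat._⊓_ x (minL (y ∷ s))
maxL = foldr Data.Nat._⊔_ 0

_⪯_ : List ℕ → List ℕ → Bool
B′ ⪯ B = ⌊ minL B ≤? minL B′ ⌋ ∧ ⌊ maxL B′ ≤? maxL B ⌋

⌈_/_⌉ : ℕ → ℕ → ℕ
⌈ x / zero  ⌉ = 0
⌈ x / suc k ⌉ = x / suc k + (if ⌊ (x Data.Nat.% suc k) ≟ 0 ⌋ then 0 else 1)

Σℤ : List ℤ → ℤ
Σℤ = foldr ℤ._+_ (+ 0)

-- The blocks of π(D), each listed once: j is taken as the representative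
-- of its block when j is the least element of its block.
isBlockMin : (a b : ℕ) → DyckPath a b → ℕ → Bool
isBlockMin a b D j = ⌊ minL (blockOf a b D j) ≟ j ⌋

blocks : (a b : ℕ) → DyckPath a b → List (List ℕ)
blocks a b D = map (blockOf a b D)
  (filter (λ j → isBlockMin a b D j Data.Bool.≟ true) [1… b ∸ 1 ])

IsRank : (a b : ℕ) → DyckPath a b → (List ℕ → ℤ) → Set
IsRank a b D r = ∀ B → B ∈ blocks a b D →
  Σℤ (map r (filter (λ B′ → (B′ ⪯ B) Data.Bool.≟ true) (blocks a b D)))
    ≡ + ⌈ (maxL B ∸ minL B + 1) * a / b ⌉

MDivisible : (a b : ℕ) → DyckPath a b → ℕ → Set
MDivisible a b D m = ∀ B → B ∈ blocks a b D → m ∣ length B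

-- Since each laser cuts off an interval of labels, π(D) is noncrossing: the blocks B′ ⪯ B are
-- exactly the blocks meeting [min B, max B], and they partition that interval.  If every block
-- has size divisible by m, the sum of |B′|/m over B′ ⪯ B is therefore K = (max B − min B + 1)/m
-- with 1 ≤ K ≤ n, and ⌈mK·n/(mn+1)⌉ = ⌈K − K/(mn+1)⌉ = K; so B ↦ |B|/m is a rank function.
-- It is the only one: the defining equation of B determines the rank of B from the ranks of the
-- blocks strictly nested in B, which have smaller width max − min.

module Submission where

open import Defs
import Data.Integer.Properties as ℤP
open import Algebra.Properties.AbelianGroup ℤP.+-0-abelianGroup using (∙-cancelˡ; ∙-cancelʳ)
open import Data.Bool using (Bool; true; false; _∧_; if_then_else_)
import Data.Bool as Bool
open import Data.Bool.Properties using (∧-assoc; ∧-identityʳ; ∧-zeroʳ; if-cong; if-float)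
open import Data.Empty using (⊥-elim)
open import Data.Integer using (ℤ; +_)
import Data.Integer as ℤ
open import Data.List using (List; []; _∷_; _++_; length; filter; map)
open import Data.List.Membership.Propositional using (_∈_)
open import Data.List.Membership.Propositional.Properties
  using (∈-filter⁺; ∈-filter⁻; ∈-map⁺; ∈-map⁻)
open import Data.List.Properties
  using (filter-++; filter-all; filter-none; filter-≐; ++-identityʳ; map-cong; map-cong-local; map-∘)
open import Data.List.Relation.Unary.All using (tabulate)
open import Data.List.Relation.Unary.Any using (here; there)
open import Data.Nat using (ℕ; zero; suc; _+_; _*_; _∸_; _≤_; _<_; _/_; _%_; NonZero; z≤n; s≤s)
open import Data.Nat.DivMod using (+-distrib-/-∣ʳ; m<n⇒m/n≡0; m*n/n≡m; [m+kn]%n≡m%n; m<n⇒m%n≡m; m*[n/m]≡n)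
open import Data.Nat.Divisibility using (divides-refl)
open import Data.Nat.ListAction using (sum)
open import Data.Nat.Properties
open import Algebra.Properties.CommutativeSemigroup +-commutativeSemigroup using (interchange)
open import Data.Product using (Σ; _×_; _,_; proj₁; proj₂; Σ-syntax)
open import Data.Sum using (inj₁; inj₂; [_,_]′)
open import Function using (_∘′_)
open import Function.Bundles using (_⇔_; mk⇔; Equivalence)
open import Relation.Nullary using (Dec; yes; no; ¬_)
open import Relation.Nullary.Decidable using (⌊_⌋)
open import Relation.Binary.PropositionalEquality

open Equivalence using (to; from)

from-⌊⌋ : ∀ {p} {P : Set p} (P? : Dec P) → ⌊ P? ⌋ ≡ true → P
from-⌊⌋ (yes p) _ = p

to-⌊⌋ : ∀ {p} {P : Set p} (P? : Dec P) → P → ⌊ P? ⌋ ≡ true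
to-⌊⌋ (yes _) _ = refl
to-⌊⌋ (no ¬p) p = ⊥-elim (¬p p)

∧-true⁻ : ∀ {x y} → x ∧ y ≡ true → x ≡ true × y ≡ true
∧-true⁻ {true} y≡true = refl , y≡true

∧-true⁺ : ∀ {x y} → x ≡ true → y ≡ true → x ∧ y ≡ true
∧-true⁺ refl y≡true = y≡true

allB-∈ : ∀ {A : Set} (p : A → Bool) {xs x} → allB p xs ≡ true → x ∈ xs → p x ≡ true
allB-∈ p {x ∷ xs} h (here refl) = proj₁ (∧-true⁻ h)
allB-∈ p {x ∷ xs} h (there x∈) = allB-∈ p (proj₂ (∧-true⁻ {p x} h)) x∈

allB-intro : ∀ {A : Set} (p : A → Bool) xs → (∀ {x} → x ∈ xs → p x ≡ true) → allB p xs ≡ true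
allB-intro p []       h = refl
allB-intro p (x ∷ xs) h = ∧-true⁺ (h (here refl)) (allB-intro p xs (h ∘′ there))

allB-++ : ∀ {A : Set} (p : A → Bool) xs ys → allB p (xs ++ ys) ≡ allB p xs ∧ allB p ys
allB-++ p []       ys = refl
allB-++ p (x ∷ xs) ys = trans (cong (p x ∧_) (allB-++ p xs ys)) (sym (∧-assoc (p x) _ _))

range-++ : ∀ x i j → range x (i + j) ≡ range x i ++ range (x + i) j
range-++ x zero    j = cong (λ y → range y j) (sym (+-identityʳ x))
range-++ x (suc i) j =
  cong (suc x ∷_) (trans (range-++ (suc x) i j) (cong (λ y → range (suc x) i ++ range y j) (sym (+-suc x i))))

∈-range⁻ : ∀ {y} x k → y ∈ range x k → x < y × y ≤ x + k
∈-range⁻ x (suc k) (here refl) = ≤-refl , ≤-trans (s≤s (m≤m+n x k)) (≤-reflexive (sym (+-suc x k)))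
∈-range⁻ x (suc k) (there y∈) with ∈-range⁻ (suc x) k y∈
... | x<y , y≤ = <-trans (n<1+n x) x<y , ≤-trans y≤ (≤-reflexive (sym (+-suc x k)))

∈-range⁺ : ∀ {y} x k → x < y → y ≤ x + k → y ∈ range x k
∈-range⁺ x zero    x<y y≤x+0 = ⊥-elim (<⇒≱ x<y (≤-trans y≤x+0 (≤-reflexive (+-identityʳ x))))
∈-range⁺ {y} x (suc k) x<y y≤ with suc x ≟ y
... | yes refl = here refl
... | no 1+x≢y = there (∈-range⁺ (suc x) k (≤∧≢⇒< x<y 1+x≢y) (≤-trans y≤ (≤-reflexive (+-suc x k))))

length-range : ∀ x k → length (range x k) ≡ k
length-range x zero    = refl
length-range x (suc k) = cong suc (length-range (suc x) k)

range-head∉tail : ∀ {r} x k → r ∈ range (suc x) k → r ≢ suc x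
range-head∉tail x k r∈ refl = <-irrefl refl (proj₁ (∈-range⁻ (suc x) k r∈))

sum-map-+ : ∀ {A : Set} (f g : A → ℕ) xs → sum (map (λ x → f x + g x) xs) ≡ sum (map f xs) + sum (map g xs)
sum-map-+ f g []       = refl
sum-map-+ f g (x ∷ xs) = trans (cong (_+_ (f x + g x)) (sum-map-+ f g xs)) (interchange (f x) (g x) _ _)

sum-map-0 : ∀ {A : Set} (xs : List A) → sum (map (λ _ → 0) xs) ≡ 0
sum-map-0 []       = refl
sum-map-0 (x ∷ xs) = sum-map-0 xs

sum-map-* : ∀ {A : Set} k (f : A → ℕ) xs → sum (map (λ x → k * f x) xs) ≡ k * sum (map f xs)
sum-map-* k f []       = sym (*-zeroʳ k)
sum-map-* k f (x ∷ xs) = trans (cong (_+_ (k * f x)) (sum-map-* k f xs)) (sym (*-distribˡ-+ k (f x) _))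

sum-map-swap : ∀ {A B : Set} (f : A → B → ℕ) xs ys →
  sum (map (λ x → sum (map (f x) ys)) xs) ≡ sum (map (λ y → sum (map (λ x → f x y) xs)) ys)
sum-map-swap f []       ys = sym (sum-map-0 ys)
sum-map-swap f (x ∷ xs) ys = trans (cong (_+_ (sum (map (f x) ys))) (sum-map-swap f xs ys))
  (sym (sum-map-+ (f x) (λ y → sum (map (λ x′ → f x′ y) xs)) ys))

length-filter≡sum : ∀ {A : Set} (p : A → Bool) xs →
  length (filter (λ x → p x Bool.≟ true) xs) ≡ sum (map (λ x → if p x then 1 else 0) xs)
length-filter≡sum p []       = refl
length-filter≡sum p (x ∷ xs) with p x
... | true  = cong suc (length-filter≡sum p xs)
... | false = length-filter≡sum p xs

sum-map-range-point : ∀ (f : ℕ → ℕ) x k {p} → p ∈ range x k →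
  (∀ {r} → r ∈ range x k → r ≢ p → f r ≡ 0) → sum (map f (range x k)) ≡ f p
sum-map-range-point f x (suc k) (here refl) off-p = begin
  f (suc x) + sum (map f (range (suc x) k))
    ≡⟨ cong (_+_ (f (suc x)) ∘′ sum) (map-cong-local (tabulate λ r∈ → off-p (there r∈) (range-head∉tail x k r∈))) ⟩
  f (suc x) + sum (map (λ _ → 0) (range (suc x) k))
    ≡⟨ cong (_+_ (f (suc x))) (sum-map-0 (range (suc x) k)) ⟩
  f (suc x) + 0
    ≡⟨ +-identityʳ (f (suc x)) ⟩
  f (suc x) ∎
  where open ≡-Reasoning
sum-map-range-point f x (suc k) (there p∈) off-p =
  trans (cong (_+ sum (map f (range (suc x) k))) (off-p (here refl) (≢-sym (range-head∉tail x k p∈))))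
        (sum-map-range-point f (suc x) k p∈ (off-p ∘′ there))

Σℤ-map-+ : ∀ ns → Σℤ (map +_ ns) ≡ + sum ns
Σℤ-map-+ []       = refl
Σℤ-map-+ (n ∷ ns) = cong (ℤ._+_ (+ n)) (Σℤ-map-+ ns)

Σℤ-map-filter-map-filter : ∀ {A B : Set} (g : B → ℤ) (q : B → Bool) (h : A → B) (p : A → Bool) xs →
  Σℤ (map g (filter (λ y → q y Bool.≟ true) (map h (filter (λ x → p x Bool.≟ true) xs))))
    ≡ Σℤ (map (λ x → if p x ∧ q (h x) then g (h x) else + 0) xs)
Σℤ-map-filter-map-filter g q h p []       = refl
Σℤ-map-filter-map-filter g q h p (x ∷ xs) with p x
... | false = trans (Σℤ-map-filter-map-filter g q h p xs) (sym (ℤP.+-identityˡ _))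
... | true with q (h x)
...   | true  = cong (ℤ._+_ (g (h x))) (Σℤ-map-filter-map-filter g q h p xs)
...   | false = trans (Σℤ-map-filter-map-filter g q h p xs) (sym (ℤP.+-identityˡ _))

Σℤ-range-agree-except : ∀ (f g : ℕ → ℤ) x k {p} → p ∈ range x k →
  (∀ {r} → r ∈ range x k → r ≢ p → f r ≡ g r) →
  Σℤ (map f (range x k)) ≡ Σℤ (map g (range x k)) → f p ≡ g p
Σℤ-range-agree-except f g x (suc k) (here refl) off-p sums≡ = ∙-cancelʳ _ (f (suc x)) (g (suc x))
  (trans sums≡ (cong (ℤ._+_ (g (suc x)) ∘′ Σℤ) (sym (map-cong-local
    (tabulate λ r∈ → off-p (there r∈) (range-head∉tail x k r∈))))))
Σℤ-range-agree-except f g x (suc k) (there p∈) off-p sums≡ =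
  Σℤ-range-agree-except f g (suc x) k p∈ (off-p ∘′ there) (∙-cancelˡ (f (suc x)) _ _
    (trans sums≡ (cong (ℤ._+ Σℤ (map g (range (suc x) k)))
      (sym (off-p (here refl) (≢-sym (range-head∉tail x k p∈)))))))

length-filter-interval : ∀ (p : ℕ → Bool) k {lo hi} → 1 ≤ lo → lo ≤ hi → hi ≤ k →
  (∀ {j} → j ∈ [1… k ] → (p j ≡ true ⇔ (lo ≤ j × j ≤ hi))) →
  length (filter (λ j → p j Bool.≟ true) [1… k ]) ≡ hi ∸ lo + 1
length-filter-interval p k {suc l} {hi} _ lo≤hi hi≤k p⇔ = begin
  length (filter P? (range 0 k))
    ≡⟨ cong (length ∘′ filter P?) segments ⟩
  length (filter P? (range 0 l ++ range l (hi ∸ l) ++ range hi (k ∸ hi)))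
    ≡⟨ cong length filtered ⟩
  length (range l (hi ∸ l) ++ [])
    ≡⟨ cong length (++-identityʳ (range l (hi ∸ l))) ⟩
  length (range l (hi ∸ l))
    ≡⟨ length-range l (hi ∸ l) ⟩
  suc hi ∸ suc l
    ≡⟨ +-∸-assoc 1 lo≤hi ⟩
  1 + (hi ∸ suc l)
    ≡⟨ +-comm 1 _ ⟩
  hi ∸ suc l + 1 ∎
  where
  open ≡-Reasoning
  P? = λ j → p j Bool.≟ true
  l≤hi = ≤-trans (n≤1+n l) lo≤hi
  segments : range 0 k ≡ range 0 l ++ range l (hi ∸ l) ++ range hi (k ∸ hi)
  segments = begin
    range 0 k
      ≡⟨ cong (range 0) (sym (trans (sym (+-assoc l (hi ∸ l) (k ∸ hi)))
           (trans (cong (_+ (k ∸ hi)) (m+[n∸m]≡n l≤hi)) (m+[n∸m]≡n hi≤k)))) ⟩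
    range 0 (l + ((hi ∸ l) + (k ∸ hi)))
      ≡⟨ range-++ 0 l _ ⟩
    range 0 l ++ range l ((hi ∸ l) + (k ∸ hi))
      ≡⟨ cong (range 0 l ++_) (range-++ l (hi ∸ l) (k ∸ hi)) ⟩
    range 0 l ++ range l (hi ∸ l) ++ range (l + (hi ∸ l)) (k ∸ hi)
      ≡⟨ cong (λ t → range 0 l ++ range l (hi ∸ l) ++ range t (k ∸ hi)) (m+[n∸m]≡n l≤hi) ⟩
    range 0 l ++ range l (hi ∸ l) ++ range hi (k ∸ hi) ∎
  in-[1…k] : ∀ {y} → 0 < y → y ≤ k → y ∈ [1… k ]
  in-[1…k] = ∈-range⁺ 0 k
  filtered : filter P? (range 0 l ++ range l (hi ∸ l) ++ range hi (k ∸ hi)) ≡ range l (hi ∸ l) ++ []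
  filtered = begin
    filter P? (range 0 l ++ range l (hi ∸ l) ++ range hi (k ∸ hi))
      ≡⟨ filter-++ P? (range 0 l) _ ⟩
    filter P? (range 0 l) ++ filter P? (range l (hi ∸ l) ++ range hi (k ∸ hi))
      ≡⟨ cong₂ _++_ (filter-none P? (tabulate left)) (filter-++ P? (range l (hi ∸ l)) _) ⟩
    filter P? (range l (hi ∸ l)) ++ filter P? (range hi (k ∸ hi))
      ≡⟨ cong₂ _++_ (filter-all P? (tabulate middle)) (filter-none P? (tabulate right)) ⟩
    range l (hi ∸ l) ++ [] ∎
    where
    left : ∀ {y} → y ∈ range 0 l → ¬ (p y ≡ true)
    left y∈ py with ∈-range⁻ 0 l y∈
    ... | 0<y , y≤l = <⇒≱ (s≤s y≤l) (proj₁ (to (p⇔ (in-[1…k] 0<y (≤-trans y≤l (≤-trans l≤hi hi≤k)))) py))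
    middle : ∀ {y} → y ∈ range l (hi ∸ l) → p y ≡ true
    middle y∈ with ∈-range⁻ l (hi ∸ l) y∈
    ... | l<y , y≤ = from (p⇔ (in-[1…k] (≤-trans (s≤s z≤n) l<y) (≤-trans y≤hi hi≤k))) (l<y , y≤hi)
      where y≤hi = ≤-trans y≤ (≤-reflexive (m+[n∸m]≡n l≤hi))
    right : ∀ {y} → y ∈ range hi (k ∸ hi) → ¬ (p y ≡ true)
    right y∈ py with ∈-range⁻ hi (k ∸ hi) y∈
    ... | hi<y , y≤ = <⇒≱ hi<y (proj₂ (to (p⇔ (in-[1…k] (≤-trans (s≤s z≤n) hi<y)
                        (≤-trans y≤ (≤-reflexive (m+[n∸m]≡n hi≤k))))) py))

⌈[1+r+q*d]/d⌉≡1+q : ∀ {r d} q → r < d → ⌈ suc r + q * suc d / suc d ⌉ ≡ suc q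
⌈[1+r+q*d]/d⌉≡1+q {r} {d} q r<d = begin
  (suc r + q * suc d) / suc d + (if ⌊ (suc r + q * suc d) % suc d ≟ 0 ⌋ then 0 else 1)
    ≡⟨ cong₂ (λ s t → s + (if ⌊ t ≟ 0 ⌋ then 0 else 1)) quotient remainder ⟩
  q + 1
    ≡⟨ +-comm q 1 ⟩
  suc q ∎
  where
  open ≡-Reasoning
  quotient : (suc r + q * suc d) / suc d ≡ q
  quotient = trans (+-distrib-/-∣ʳ (suc r) (divides-refl q))
                   (cong₂ _+_ (m<n⇒m/n≡0 (s≤s r<d)) (m*n/n≡m q (suc d)))
  remainder : (suc r + q * suc d) % suc d ≡ suc r
  remainder = trans ([m+kn]%n≡m%n (suc r) q (suc d)) (m<n⇒m%n≡m (s≤s r<d))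

⌈[1+k]*n/[1+n]⌉≡1+k : ∀ {n} k → k < n → ⌈ suc k * n / suc n ⌉ ≡ suc k
⌈[1+k]*n/[1+n]⌉≡1+k {suc n} k k<n = begin
  ⌈ suc k * suc n / suc (suc n) ⌉
    ≡⟨ cong ⌈_/ suc (suc n) ⌉ split ⟩
  ⌈ suc (n ∸ k) + k * suc (suc n) / suc (suc n) ⌉
    ≡⟨ ⌈[1+r+q*d]/d⌉≡1+q k (s≤s (m∸n≤m n k)) ⟩
  suc k ∎
  where
  open ≡-Reasoning
  split : suc k * suc n ≡ suc (n ∸ k) + k * suc (suc n)
  split = begin
    suc n + k * suc n           ≡⟨ cong (_+ k * suc n) (sym (m∸n+n≡m (<⇒≤ k<n))) ⟩
    (suc n ∸ k) + k + k * suc n ≡⟨ +-assoc (suc n ∸ k) k _ ⟩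
    (suc n ∸ k) + (k + k * suc n) ≡⟨ cong₂ _+_ (+-∸-assoc 1 (≤-pred k<n)) (sym (*-suc k (suc n))) ⟩
    suc (n ∸ k) + k * suc (suc n) ∎

⌈w*n/[1+m*n]⌉≡K : ∀ m n {K w} .{{_ : NonZero m}} → m * K ≡ w → 0 < w → w ≤ m * n →
  ⌈ w * n / suc (m * n) ⌉ ≡ K
⌈w*n/[1+m*n]⌉≡K m n {zero}  m*0≡w 0<w _   = ⊥-elim (<-irrefl (trans (sym (*-zeroʳ m)) m*0≡w) 0<w)
⌈w*n/[1+m*n]⌉≡K m n {suc k} refl  _   w≤ = begin
  ⌈ m * suc k * n / suc (m * n) ⌉
    ≡⟨ cong ⌈_/ suc (m * n) ⌉ (trans (cong (_* n) (*-comm m (suc k))) (*-assoc (suc k) m n)) ⟩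
  ⌈ suc k * (m * n) / suc (m * n) ⌉
    ≡⟨ ⌈[1+k]*n/[1+n]⌉≡1+k k (≤-trans (m≤n*m (suc k) m) w≤) ⟩
  suc k ∎
  where open ≡-Reasoning

minL-≤ : ∀ {x} xs → x ∈ xs → minL xs ≤ x
minL-≤ (x ∷ [])     (here refl) = ≤-refl
minL-≤ (x ∷ y ∷ xs) (here refl) = m⊓n≤m x _
minL-≤ (x ∷ y ∷ xs) (there x∈)  = ≤-trans (m⊓n≤n x _) (minL-≤ (y ∷ xs) x∈)

minL-∈ : ∀ {x} xs → x ∈ xs → minL xs ∈ xs
minL-∈ (x ∷ [])     _ = here refl
minL-∈ (x ∷ y ∷ xs) _ =
  [ here , (λ x⊓m≡m → there (subst (_∈ y ∷ xs) (sym x⊓m≡m) (minL-∈ (y ∷ xs) (here refl)))) ]′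
    (⊓-sel x (minL (y ∷ xs)))

≤-maxL : ∀ {x} xs → x ∈ xs → x ≤ maxL xs
≤-maxL (x ∷ xs) (here refl) = m≤m⊔n x _
≤-maxL (x ∷ xs) (there x∈)  = ≤-trans (≤-maxL xs x∈) (m≤n⊔m x _)

maxL-∈ : ∀ {x} xs → x ∈ xs → maxL xs ∈ xs
maxL-∈ (x ∷ [])     _ = here (⊔-identityʳ x)
maxL-∈ (x ∷ y ∷ xs) _ =
  [ here , (λ x⊔m≡m → there (subst (_∈ y ∷ xs) (sym x⊔m≡m) (maxL-∈ (y ∷ xs) (here refl)))) ]′
    (⊔-sel x (maxL (y ∷ xs)))

⪯⇔ : ∀ B′ B → (B′ ⪯ B) ≡ true ⇔ (minL B ≤ minL B′ × maxL B′ ≤ maxL B)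
⪯⇔ B′ B = mk⇔
  (λ h → from-⌊⌋ (minL B ≤? minL B′) (proj₁ (∧-true⁻ h)) , from-⌊⌋ (maxL B′ ≤? maxL B) (proj₂ (∧-true⁻ h)))
  (λ (p , q) → ∧-true⁺ (to-⌊⌋ (minL B ≤? minL B′) p) (to-⌊⌋ (maxL B′ ≤? maxL B) q))

underLaser-convex : ∀ a b s P {i j k} → i ≤ j → j ≤ k →
  underLaser a b s P i ≡ true → underLaser a b s P k ≡ true → underLaser a b s P j ≡ true
underLaser-convex a b s (x , y) {i} {j} {k} i≤j j≤k under-i under-k =
  ∧-true⁺ (to-⌊⌋ (x <? j) x<j) (proj₁ (∧-true⁻ prefix++suffix))
  where
  open ≡-Reasoning
  below : ℕ → Bool
  below c = ⌊ b * y + a * c <? b * eastHeight s c + a * x ⌋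
  x<j : x < j
  x<j = <-≤-trans (from-⌊⌋ (x <? i) (proj₁ (∧-true⁻ under-i))) i≤j
  split : k ∸ x ≡ (j ∸ x) + (k ∸ j)
  split = begin
    k ∸ x             ≡⟨ cong (_∸ x) (sym (m+[n∸m]≡n j≤k)) ⟩
    (j + (k ∸ j)) ∸ x ≡⟨ +-∸-comm (k ∸ j) (<⇒≤ x<j) ⟩
    (j ∸ x) + (k ∸ j) ∎
  prefix++suffix : allB below (range x (j ∸ x)) ∧ allB below (range (x + (j ∸ x)) (k ∸ j)) ≡ true
  prefix++suffix = begin
    allB below (range x (j ∸ x)) ∧ allB below (range (x + (j ∸ x)) (k ∸ j))
      ≡⟨ sym (allB-++ below (range x (j ∸ x)) _) ⟩
    allB below (range x (j ∸ x) ++ range (x + (j ∸ x)) (k ∸ j))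
      ≡⟨ cong (allB below) (sym (range-++ x (j ∸ x) (k ∸ j))) ⟩
    allB below (range x ((j ∸ x) + (k ∸ j)))
      ≡⟨ cong (λ t → allB below (range x t)) (sym split) ⟩
    allB below (range x (k ∸ x))
      ≡⟨ proj₂ (∧-true⁻ {⌊ x <? k ⌋} under-k) ⟩
    true ∎

unseparated⇒sameSide : ∀ a b s P i j → (if separates a b s P i j then false else true) ≡ true →
  underLaser a b s P i ≡ underLaser a b s P j
unseparated⇒sameSide a b s P i j h with underLaser a b s P i | underLaser a b s P j
unseparated⇒sameSide a b s P i j h  | true  | true  = refl
unseparated⇒sameSide a b s P i j h  | false | false = refl
unseparated⇒sameSide a b s P i j () | true  | false
unseparated⇒sameSide a b s P i j () | false | true

sameSide⇒unseparated : ∀ a b s P i j → underLaser a b s P i ≡ underLaser a b s P j →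
  (if separates a b s P i j then false else true) ≡ true
sameSide⇒unseparated a b s P i j h with underLaser a b s P i | underLaser a b s P j
sameSide⇒unseparated a b s P i j h  | true  | true  = refl
sameSide⇒unseparated a b s P i j h  | false | false = refl
sameSide⇒unseparated a b s P i j () | true  | false
sameSide⇒unseparated a b s P i j () | false | true

module Noncrossing {a b : ℕ} (D : DyckPath a b) where

  private
    laser : ℕ × ℕ → ℕ → Bool
    laser = underLaser a b (steps D)

  infix 4 _∼_
  _∼_ : ℕ → ℕ → Set
  i ∼ j = sameBlock a b D i j ≡ true

  ∼⇒sameSide : ∀ {i j P} → i ∼ j → P ∈ valleys (steps D) → laser P i ≡ laser P j
  ∼⇒sameSide {i} {j} {P} i∼j P∈ = unseparated⇒sameSide a b (steps D) P i j (allB-∈ _ i∼j P∈)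

  sameSide⇒∼ : ∀ {i j} → (∀ {P} → P ∈ valleys (steps D) → laser P i ≡ laser P j) → i ∼ j
  sameSide⇒∼ {i} {j} same = allB-intro _ _ (λ {P} P∈ → sameSide⇒unseparated a b (steps D) P i j (same P∈))

  ∼-refl : ∀ i → i ∼ i
  ∼-refl i = sameSide⇒∼ (λ _ → refl)

  ∼-sym : ∀ {i j} → i ∼ j → j ∼ i
  ∼-sym i∼j = sameSide⇒∼ (λ P∈ → sym (∼⇒sameSide i∼j P∈))

  ∼-trans : ∀ {i j k} → i ∼ j → j ∼ k → i ∼ k
  ∼-trans i∼j j∼k = sameSide⇒∼ (λ P∈ → trans (∼⇒sameSide i∼j P∈) (∼⇒sameSide j∼k P∈))

  -- A laser cuts off an interval of labels, so a laser separating i from j would separate i from k or j from l.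
  crossing⇒∼ : ∀ {i j k l} → i ≤ j → j ≤ k → k ≤ l → i ∼ k → j ∼ l → i ∼ j
  crossing⇒∼ {i} {j} i≤j j≤k k≤l i∼k j∼l = sameSide⇒∼ same
    where
    same : ∀ {P} → P ∈ valleys (steps D) → laser P i ≡ laser P j
    same {P} P∈ with laser P i in under-i | laser P j in under-j
    ... | true  | true  = refl
    ... | false | false = refl
    ... | true  | false = trans (sym (underLaser-convex a b (steps D) P i≤j j≤k under-i
                            (trans (sym (∼⇒sameSide i∼k P∈)) under-i))) under-j
    ... | false | true  = trans (sym under-i) (trans (∼⇒sameSide i∼k P∈)
                            (underLaser-convex a b (steps D) P j≤k k≤l under-j
                              (trans (sym (∼⇒sameSide j∼l P∈)) under-j)))

  U : List ℕ
  U = [1… b ∸ 1 ]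

  block : ℕ → List ℕ
  block = blockOf a b D

  width : ℕ → ℕ
  width r = maxL (block r) ∸ r

  ∈-block⁻ : ∀ {i j} → j ∈ block i → j ∈ U × i ∼ j
  ∈-block⁻ {i} = ∈-filter⁻ (λ j → sameBlock a b D i j Bool.≟ true)

  ∈-block⁺ : ∀ {i j} → j ∈ U → i ∼ j → j ∈ block i
  ∈-block⁺ {i} = ∈-filter⁺ (λ j → sameBlock a b D i j Bool.≟ true)

  ∈-block-self : ∀ {i} → i ∈ U → i ∈ block i
  ∈-block-self i∈U = ∈-block⁺ i∈U (∼-refl _)

  block-cong : ∀ {i j} → i ∼ j → block i ≡ block j
  block-cong i∼j = filter-≐ (λ x → sameBlock a b D _ x Bool.≟ true) (λ x → sameBlock a b D _ x Bool.≟ true)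
    (∼-trans (∼-sym i∼j) , ∼-trans i∼j) U

  ∈-blocks⁻ : ∀ {B} → B ∈ blocks a b D → Σ[ r ∈ ℕ ] r ∈ U × isBlockMin a b D r ≡ true × B ≡ block r
  ∈-blocks⁻ B∈ with ∈-map⁻ block B∈
  ... | r , r∈ , refl with ∈-filter⁻ (λ j → isBlockMin a b D j Bool.≟ true) r∈
  ...   | r∈U , isMin = r , r∈U , isMin , refl

  ∈-blocks⁺ : ∀ {r} → r ∈ U → isBlockMin a b D r ≡ true → block r ∈ blocks a b D
  ∈-blocks⁺ r∈U isMin = ∈-map⁺ block (∈-filter⁺ (λ j → isBlockMin a b D j Bool.≟ true) r∈U isMin)

  isBlockMin⇒min≡ : ∀ {r} → isBlockMin a b D r ≡ true → minL (block r) ≡ r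
  isBlockMin⇒min≡ {r} = from-⌊⌋ (minL (block r) ≟ r)

  rep : ℕ → ℕ
  rep j = minL (block j)

  rep∈block : ∀ {j} → j ∈ U → rep j ∈ block j
  rep∈block j∈U = minL-∈ _ (∈-block-self j∈U)

  isBlockMin-rep : ∀ {j} → j ∈ U → isBlockMin a b D (rep j) ≡ true
  isBlockMin-rep {j} j∈U = to-⌊⌋ (minL (block (rep j)) ≟ rep j)
    (cong minL (block-cong (∼-sym (proj₂ (∈-block⁻ (rep∈block j∈U))))))

  block-bounds : ∀ {lo x} → minL (block lo) ≡ lo → x ∈ block lo → lo ≤ x × x ≤ maxL (block lo)
  block-bounds min≡lo x∈ = subst (_≤ _) min≡lo (minL-≤ _ x∈) , ≤-maxL _ x∈

  ∼-max : ∀ {lo} → lo ∈ U → lo ∼ maxL (block lo)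
  ∼-max lo∈U = proj₂ (∈-block⁻ (maxL-∈ _ (∈-block-self lo∈U)))

  max-bounds : ∀ {lo} → lo ∈ U → minL (block lo) ≡ lo → lo ≤ maxL (block lo) × maxL (block lo) ≤ b ∸ 1
  max-bounds lo∈U min≡lo =
    proj₁ (block-bounds min≡lo max∈) , proj₂ (∈-range⁻ 0 (b ∸ 1) (proj₁ (∈-block⁻ max∈)))
    where max∈ = maxL-∈ _ (∈-block-self lo∈U)

  inner-block-within : ∀ {lo j x} → lo ∈ U → minL (block lo) ≡ lo → lo ≤ j → j ≤ maxL (block lo) →
    x ∈ block j → lo ≤ x × x ≤ maxL (block lo)
  inner-block-within {lo} {x = x} lo∈U min≡lo lo≤j j≤hi x∈
    with ∈-block⁻ x∈ | ≤-total lo x | ≤-total x (maxL (block lo))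
  ... | _ , _ | inj₁ lo≤x | inj₁ x≤hi = lo≤x , x≤hi
  ... | x∈U , j∼x | _ | inj₂ hi≤x =
    block-bounds min≡lo (∈-block⁺ x∈U (∼-trans (crossing⇒∼ lo≤j j≤hi hi≤x (∼-max lo∈U) j∼x) j∼x))
  ... | x∈U , j∼x | inj₂ x≤lo | inj₁ _ =
    block-bounds min≡lo (∈-block⁺ x∈U (∼-sym (crossing⇒∼ x≤lo lo≤j j≤hi (∼-sym j∼x) (∼-max lo∈U))))

  ⪯-block⇔within : ∀ {lo j} → lo ∈ U → minL (block lo) ≡ lo → j ∈ U →
    (block j ⪯ block lo) ≡ true ⇔ (lo ≤ j × j ≤ maxL (block lo))
  ⪯-block⇔within {lo} {j} lo∈U min≡lo j∈U = mk⇔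
    (λ h → let min≤ , max≤ = to (⪯⇔ (block j) (block lo)) h in
      ≤-trans (subst (_≤ _) min≡lo min≤) (minL-≤ _ j∈) , ≤-trans (≤-maxL _ j∈) max≤)
    (λ (lo≤j , j≤hi) → from (⪯⇔ (block j) (block lo))
      ( subst (_≤ _) (sym min≡lo) (proj₁ (inner-block-within lo∈U min≡lo lo≤j j≤hi (minL-∈ _ j∈)))
      , proj₂ (inner-block-within lo∈U min≡lo lo≤j j≤hi (maxL-∈ _ j∈))))
    where j∈ = ∈-block-self j∈U

  isRepBelow : List ℕ → ℕ → Bool
  isRepBelow B r = isBlockMin a b D r ∧ (block r ⪯ B)

  isRepBelow⁻ : ∀ B r → isRepBelow B r ≡ true → isBlockMin a b D r ≡ true × (block r ⪯ B) ≡ true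
  isRepBelow⁻ B r = ∧-true⁻ {isBlockMin a b D r}

  -- Among the representatives only rep j lies in the block of j.
  count-reps-below : ∀ B {j} → j ∈ U →
    sum (map (λ r → if isRepBelow B r ∧ sameBlock a b D r j then 1 else 0) U) ≡ (if block j ⪯ B then 1 else 0)
  count-reps-below B {j} j∈U = begin
    sum (map f U)
      ≡⟨ sum-map-range-point f 0 (b ∸ 1) (proj₁ (∈-block⁻ (rep∈block j∈U))) off-rep ⟩
    f (rep j)
      ≡⟨ if-cong (begin
           (isBlockMin a b D (rep j) ∧ (block (rep j) ⪯ B)) ∧ sameBlock a b D (rep j) j
             ≡⟨ cong₂ (λ m s → (m ∧ (block (rep j) ⪯ B)) ∧ s) (isBlockMin-rep j∈U) rep∼j ⟩
           (block (rep j) ⪯ B) ∧ true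
             ≡⟨ ∧-identityʳ _ ⟩
           block (rep j) ⪯ B
             ≡⟨ cong (_⪯ B) (block-cong rep∼j) ⟩
           block j ⪯ B ∎) ⟩
    (if block j ⪯ B then 1 else 0) ∎
    where
    open ≡-Reasoning
    f : ℕ → ℕ
    f r = if isRepBelow B r ∧ sameBlock a b D r j then 1 else 0
    rep∼j = ∼-sym (proj₂ (∈-block⁻ (rep∈block j∈U)))
    off-rep : ∀ {r} → r ∈ U → r ≢ rep j → f r ≡ 0
    off-rep {r} _ r≢rep with isBlockMin a b D r in isMin | sameBlock a b D r j in r∼j
    ... | false | _     = refl
    ... | true  | false = cong (λ t → if t then 1 else 0) (∧-zeroʳ (block r ⪯ B))
    ... | true  | true  = ⊥-elim (r≢rep (trans (sym (isBlockMin⇒min≡ isMin)) (cong minL (block-cong r∼j))))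

  -- Double counting: every label of [min B, max B] lies in exactly one block nested in B.
  nested-sizes : ∀ {lo} → lo ∈ U → minL (block lo) ≡ lo →
    sum (map (λ r → if isRepBelow (block lo) r then length (block r) else 0) U) ≡ width lo + 1
  nested-sizes {lo} lo∈U min≡lo = begin
    sum (map (λ r → if below r then length (block r) else 0) U)
      ≡⟨ cong sum (map-cong size-as-count U) ⟩
    sum (map (λ r → sum (map (λ j → if below r ∧ sameBlock a b D r j then 1 else 0) U)) U)
      ≡⟨ sum-map-swap (λ r j → if below r ∧ sameBlock a b D r j then 1 else 0) U U ⟩
    sum (map (λ j → sum (map (λ r → if below r ∧ sameBlock a b D r j then 1 else 0) U)) U)
      ≡⟨ cong sum (map-cong-local (tabulate (count-reps-below (block lo)))) ⟩
    sum (map (λ j → if block j ⪯ block lo then 1 else 0) U)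
      ≡⟨ sym (length-filter≡sum (λ j → block j ⪯ block lo) U) ⟩
    length (filter (λ j → (block j ⪯ block lo) Bool.≟ true) U)
      ≡⟨ length-filter-interval (λ j → block j ⪯ block lo) (b ∸ 1) (proj₁ (∈-range⁻ 0 (b ∸ 1) lo∈U))
           (proj₁ (max-bounds lo∈U min≡lo)) (proj₂ (max-bounds lo∈U min≡lo)) (⪯-block⇔within lo∈U min≡lo) ⟩
    width lo + 1 ∎
    where
    open ≡-Reasoning
    below = isRepBelow (block lo)
    size-as-count : ∀ r → (if below r then length (block r) else 0)
                        ≡ sum (map (λ j → if below r ∧ sameBlock a b D r j then 1 else 0) U)
    size-as-count r with below r
    ... | true  = length-filter≡sum (sameBlock a b D r) U
    ... | false = sym (sum-map-0 U)

  Σℤ-below : ∀ (g : List ℕ → ℤ) B →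
    Σℤ (map g (filter (λ B′ → (B′ ⪯ B) Bool.≟ true) (blocks a b D)))
      ≡ Σℤ (map (λ r → if isRepBelow B r then g (block r) else + 0) U)
  Σℤ-below g B = Σℤ-map-filter-map-filter g (_⪯ B) block (isBlockMin a b D) U

  width-nested< : ∀ {lo r} → minL (block lo) ≡ lo → r ∈ U → isRepBelow (block lo) r ≡ true → r ≢ lo →
    width r < width lo
  width-nested< {lo} {r} min≡lo r∈U below r≢lo = begin-strict
    maxL (block r) ∸ r   ≤⟨ ∸-monoˡ-≤ r max≤ ⟩
    maxL (block lo) ∸ r  <⟨ ∸-monoʳ-< lo<r (≤-trans (≤-maxL _ (∈-block-self r∈U)) max≤) ⟩
    maxL (block lo) ∸ lo ∎
    where
    open ≤-Reasoning
    bounds = to (⪯⇔ (block r) (block lo)) (proj₂ (isRepBelow⁻ (block lo) r below))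
    max≤ = proj₂ bounds
    lo<r : lo < r
    lo<r = ≤∧≢⇒< (subst₂ _≤_ min≡lo (isBlockMin⇒min≡ (proj₁ (isRepBelow⁻ (block lo) r below))) (proj₁ bounds))
                 (r≢lo ∘′ sym)

  -- The block itself is the only term of its defining sum not covered by induction on the width.
  IsRank-unique : ∀ {r r′} → IsRank a b D r → IsRank a b D r′ → ∀ {B} → B ∈ blocks a b D → r B ≡ r′ B
  IsRank-unique {r} {r′} rank rank′ B∈ with ∈-blocks⁻ B∈
  ... | lo , lo∈U , isMin , refl = by-width (suc (width lo)) lo∈U isMin ≤-refl
    where
    term : (List ℕ → ℤ) → List ℕ → ℕ → ℤ
    term g B x = if isRepBelow B x then g (block x) else + 0
    by-width : ∀ d {lo} → lo ∈ U → isBlockMin a b D lo ≡ true → width lo < d → r (block lo) ≡ r′ (block lo)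
    by-width (suc d) {lo} lo∈U isMin width<d = begin
      r (block lo)         ≡⟨ sym (if-cong lo-below) ⟩
      term r (block lo) lo ≡⟨ Σℤ-range-agree-except (term r (block lo)) (term r′ (block lo)) 0 (b ∸ 1)
                                lo∈U nested-agree sums-agree ⟩
      term r′ (block lo) lo ≡⟨ if-cong lo-below ⟩
      r′ (block lo)        ∎
      where
      open ≡-Reasoning
      min≡lo = isBlockMin⇒min≡ isMin
      lo-below : isRepBelow (block lo) lo ≡ true
      lo-below = ∧-true⁺ isMin (from (⪯⇔ (block lo) (block lo)) (≤-refl , ≤-refl))
      sums-agree : Σℤ (map (term r (block lo)) U) ≡ Σℤ (map (term r′ (block lo)) U)
      sums-agree = trans (sym (Σℤ-below r (block lo)))
        (trans (rank (block lo) (∈-blocks⁺ lo∈U isMin))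
        (trans (sym (rank′ (block lo) (∈-blocks⁺ lo∈U isMin))) (Σℤ-below r′ (block lo))))
      nested-agree : ∀ {x} → x ∈ U → x ≢ lo → term r (block lo) x ≡ term r′ (block lo) x
      nested-agree {x} x∈U x≢lo with isRepBelow (block lo) x in below
      ... | false = refl
      ... | true  = by-width d x∈U (proj₁ (isRepBelow⁻ (block lo) x below))
                      (≤-trans (width-nested< min≡lo x∈U below x≢lo) (≤-pred width<d))

sizeRank : (m : ℕ) .{{_ : NonZero m}} → List ℕ → ℤ
sizeRank m B = + (length B / m)

sizeRank-isRank : ∀ n m .{{_ : NonZero m}} (D : DyckPath n (suc (m * n))) →
  MDivisible n (suc (m * n)) D m → IsRank n (suc (m * n)) D (sizeRank m)
sizeRank-isRank n m D m∣sizes B B∈ with Noncrossing.∈-blocks⁻ D B∈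
... | lo , lo∈U , isMin , refl = begin
  Σℤ (map (sizeRank m) (filter (λ B′ → (B′ ⪯ block lo) Bool.≟ true) (blocks n (suc (m * n)) D)))
    ≡⟨ Σℤ-below (sizeRank m) (block lo) ⟩
  Σℤ (map (λ r → if below r then + (length (block r) / m) else + 0) U)
    ≡⟨ cong Σℤ (map-cong (λ r → sym (if-float +_ (below r))) U) ⟩
  Σℤ (map (λ r → + count r) U)
    ≡⟨ cong Σℤ (map-∘ U) ⟩
  Σℤ (map +_ (map count U))
    ≡⟨ Σℤ-map-+ (map count U) ⟩
  + sum (map count U)
    ≡⟨ cong +_ (sym (⌈w*n/[1+m*n]⌉≡K m n m*total≡width+1 (m≤n+m 1 (width lo)) width+1≤mn)) ⟩
  + ⌈ (width lo + 1) * n / suc (m * n) ⌉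
    ≡⟨ cong (λ t → + ⌈ (maxL (block lo) ∸ t + 1) * n / suc (m * n) ⌉) (sym min≡lo) ⟩
  + ⌈ (maxL (block lo) ∸ minL (block lo) + 1) * n / suc (m * n) ⌉ ∎
  where
  open Noncrossing D
  open ≡-Reasoning
  below = isRepBelow (block lo)
  count : ℕ → ℕ
  count r = if below r then length (block r) / m else 0
  min≡lo = isBlockMin⇒min≡ isMin
  m*count : ∀ {r} → r ∈ U → m * count r ≡ (if below r then length (block r) else 0)
  m*count {r} r∈U with below r in r-below
  ... | true  = m*[n/m]≡n (m∣sizes (block r) (∈-blocks⁺ r∈U (proj₁ (isRepBelow⁻ (block lo) r r-below))))
  ... | false = *-zeroʳ m
  m*total≡width+1 : m * sum (map count U) ≡ width lo + 1
  m*total≡width+1 = begin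
    m * sum (map count U)                                       ≡⟨ sym (sum-map-* m count U) ⟩
    sum (map (λ r → m * count r) U)                             ≡⟨ cong sum (map-cong-local (tabulate m*count)) ⟩
    sum (map (λ r → if below r then length (block r) else 0) U) ≡⟨ nested-sizes lo∈U min≡lo ⟩
    width lo + 1                                                ∎
  width+1≤mn : width lo + 1 ≤ m * n
  width+1≤mn = ≤-trans (+-monoʳ-≤ (width lo) (proj₁ (∈-range⁻ 0 (m * n) lo∈U)))
    (≤-trans (≤-reflexive (m∸n+n≡m (proj₁ (max-bounds lo∈U min≡lo)))) (proj₂ (max-bounds lo∈U min≡lo)))

proposition3p6 : (n m : ℕ) → .{{_ : NonZero n}} → .{{_ : NonZero m}} →
    (D : DyckPath n (suc (m * n))) →
    MDivisible n (suc (m * n)) D m →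
    Σ (List ℕ → ℤ) (IsRank n (suc (m * n)) D) ×
    ((rank : List ℕ → ℤ) → IsRank n (suc (m * n)) D rank →
      ∀ B → B ∈ blocks n (suc (m * n)) D → rank B ≡ + (length B / m))
proposition3p6 n m D m∣sizes =
  (sizeRank m , sizeRank-isRank n m D m∣sizes) ,
  λ rank isRank B B∈ → Noncrossing.IsRank-unique D isRank (sizeRank-isRank n m D m∣sizes) B∈
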